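{- There is a function $C_6(t,\epsilon)$ such that the following holds for all $t\in\mathbb{N}$ and $\epsilon\in(0,1)$: let $G$ be a connected balanced bipartite graph with parts $X,Y$, with minimum degree $\delta(G)\geq C_6(t,\epsilon)$, and with no induced $S_{t,t}$. Then for all $x\in X$ and $y\in Y$ we have $d_{U_Y(\epsilon)}(x)\leq C_6(t,\epsilon)$ and $d_{U_X(\epsilon)}(y)\leq C_6(t,\epsilon)$.
   Context: $S_{t,t}$ is the graph with vertex set $\{x,x_1,\dots,x_t,y,y_1,\dots,y_t\}$ and edge set $\{xy\}\cup\{xy_1,\dots,xy_t\}\cup\{yx_1,\dots,yx_t\}$. Balanced means $|X|=|Y|$. For a vertex $v$ and set $Z$, $d_Z(v)=|N(v)\cap Z|$. For $Z\in\{X,Y\}$, $\Delta_Z=\max\{d(z):z\in Z\}$ and $U_Z(\varepsilon)=\{z\in Z : d(z)\leq (1-\varepsilon)\Delta_Z\}$.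
   Formalization: The parameter ε takes only rational values in (0,1), so the function $C_6(t,\epsilon)$ is defined on natural t and rational ε. -}

module Defs where

open import Data.Nat as ℕ using (ℕ; zero; suc; _+_; _⊔_)
open import Data.Bool using (Bool; true; false; _∧_)
open import Data.Fin using (Fin; zero; suc)
open import Data.Sum using (_⊎_; inj₁; inj₂)
open import Data.Product using (Σ; _×_; _,_)
open import Data.Integer using (+_)
open import Data.Rational as ℚ using (ℚ; 1ℚ; _-_; _*_; _/_)
open import Data.Rational.Properties using (_≤?_)
open import Relation.Nullary using (¬_)
open import Data.Empty using (⊥)
open import Relation.Nullary.Decidable using (isYes)
open import Relation.Binary.PropositionalEquality using (_≡_)
open import Function.Definitions using (Injective)

-- A balanced bipartite (simple) graph with parts X = Fin n and Y = Fin n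
-- is given by its bipartite adjacency E : X → Y → Bool (E x y ≡ true iff xy is an edge).
BipGraph : ℕ → Set
BipGraph n = Fin n → Fin n → Bool

b2n : Bool → ℕ
b2n true  = 1
b2n false = 0

count : ∀ {m} → (Fin m → Bool) → ℕ
count {zero}  p = 0
count {suc m} p = b2n (p zero) + count (λ i → p (suc i))

maxF : ∀ {m} → (Fin m → ℕ) → ℕ
maxF {zero}  f = 0
maxF {suc m} f = f zero ⊔ maxF (λ i → f (suc i))

module _ {n : ℕ} (E : BipGraph n) where

  Vertex : Set
  Vertex = Fin n ⊎ Fin n

  Adj : Vertex → Vertex → Set
  Adj (inj₁ x) (inj₂ y) = E x y ≡ true
  Adj (inj₂ y) (inj₁ x) = E x y ≡ true
  Adj (inj₁ _) (inj₁ _) = ⊥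
  Adj (inj₂ _) (inj₂ _) = ⊥

  data Reach : Vertex → Vertex → Set where
    here : ∀ {u} → Reach u u
    step : ∀ {u v w} → Adj u v → Reach v w → Reach u w

  Connected : Set
  Connected = ∀ u v → Reach u v

  degX : Fin n → ℕ
  degX x = count (λ y → E x y)

  degY : Fin n → ℕ
  degY y = count (λ x → E x y)

  deg : Vertex → ℕ
  deg (inj₁ x) = degX x
  deg (inj₂ y) = degY y

  MinDegAtLeast : ℕ → Set
  MinDegAtLeast k = ∀ v → k ℕ.≤ deg v

  ΔX ΔY : ℕ
  ΔX = maxF degX
  ΔY = maxF degY

  ℕtoℚ : ℕ → ℚ
  ℕtoℚ k = + k / 1

  inUX : ℚ → Fin n → Bool
  inUX ε x = isYes (ℕtoℚ (degX x) ≤? (1ℚ - ε) * ℕtoℚ ΔX)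

  inUY : ℚ → Fin n → Bool
  inUY ε y = isYes (ℕtoℚ (degY y) ≤? (1ℚ - ε) * ℕtoℚ ΔY)

  dUY : ℚ → Fin n → ℕ
  dUY ε x = count (λ y → E x y ∧ inUY ε y)

  dUX : ℚ → Fin n → ℕ
  dUX ε y = count (λ x → E x y ∧ inUX ε x)

  -- G contains an induced copy of S_{t,t}: distinct vertices x, x₁..x_t ∈ X,
  -- y, y₁..y_t ∈ Y with edges xy, xyᵢ, yxᵢ and no edges xᵢyⱼ (edges inside a part
  -- are impossible in a bipartite graph). Since S_{t,t} is symmetric under
  -- x ↔ y, xᵢ ↔ yᵢ, placing x on the X side loses no generality.
  record InducedStt (t : ℕ) : Set where
    field
      x  : Fin n
      y  : Fin n
      xs : Fin t → Fin n
      ys : Fin t → Fin n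
      xs-inj : Injective _≡_ _≡_ xs
      ys-inj : Injective _≡_ _≡_ ys
      x≢xs : ∀ i → ¬ (x ≡ xs i)
      y≢ys : ∀ i → ¬ (y ≡ ys i)
      e-xy  : E x y ≡ true
      e-xyᵢ : ∀ i → E x (ys i) ≡ true
      e-yxᵢ : ∀ i → E (xs i) y ≡ true
      no-xᵢyⱼ : ∀ i j → E (xs i) (ys j) ≡ false

-- Let y₀ ∈ Y have maximum degree Δ, put S = N(y₀), M = 4·↧ε and K = t·Mᵗ, and call a
-- neighbour b ≠ y of x sparse for the edge xy if b misses more than a 1/M share of
-- N(y) ∖ {x}. Fewer than K neighbours of x are sparse: among K of them a greedy dependent
-- choice finds t that jointly miss t vertices of N(y) ∖ {x}, which together with x and y
-- form an induced S_{t,t}. As N(y) ∖ {x} and S differ little when y misses few vertices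
-- of S, all but K neighbours of such an x miss few vertices of S too. Call x good if it
-- has a neighbour seeing many vertices of S. Goodness passes between two vertices with a
-- common neighbour y, through a third neighbour of y that is sparse for neither: a
-- non-sparse vertex shares more than K neighbours with the other one. By connectivity every
-- x is good. A vertex of degree at most (1 - ε)Δ misses at least εΔ vertices of S, so every
-- x has fewer than K neighbours in U_Y(ε); the bound for X follows by transposing the graph.

module Submission where

import Data.Nat.Properties as ℕₚ

open import Defs
open import Algebra.Properties.CommutativeSemigroup ℕₚ.*-commutativeSemigroup using (x∙yz≈y∙xz)
open import Algebra.Properties.Semiring.Sum ℕₚ.+-*-semiring
  using (sum; ∑-comm; ∑-distrib-+; *-distribˡ-sum; *-distribʳ-sum; sum-cong-≗)
open import Data.Bool using (Bool; true; false; _∧_; _∨_; not)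
import Data.Bool.Properties as Boolₚ
open import Data.Empty using (⊥-elim)
open import Data.Fin using (Fin; zero; suc; _≟_)
open import Data.Fin.Properties using (any?; ¬Fin0)
import Data.Fin.Properties as Finₚ
import Data.Nat as ℕ
open import Data.Nat using (ℕ; zero; suc; _+_; _*_; _^_; _≤_; _<_; _≤?_; z≤n; s≤s; NonZero)
open import Data.Nat.Tactic.RingSolver using (solve-∀)
open import Data.Product using (Σ; _×_; _,_; proj₁; proj₂)
open import Data.Rational as ℚ using (ℚ; 0ℚ; 1ℚ)
import Data.Rational.Properties as ℚₚ
open import Data.Sum using (inj₁; inj₂)
open import Data.Vec.Functional using (_∷_)
open import Function using (flip; _∘_)
open import Function.Definitions using (Injective)
open import Relation.Binary.PropositionalEquality
open import Relation.Nullary using (¬_; Dec; yes; no)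
open import Relation.Nullary.Decidable using (isYes; does; dec-true; dec-false; _×-dec_)

module _ {m : ℕ} where

  infixr 7 _∩_
  infixr 6 _∪_ _∖_
  infix 4 _⊆_

  _∩_ _∪_ _∖_ : (Fin m → Bool) → (Fin m → Bool) → Fin m → Bool
  (p ∩ q) i = p i ∧ q i
  (p ∪ q) i = p i ∨ q i
  (p ∖ q) i = p i ∧ not (q i)

  ⁅_⁆ : Fin m → Fin m → Bool
  ⁅ a ⁆ i = does (i ≟ a)

  _⊆_ : (Fin m → Bool) → (Fin m → Bool) → Set
  p ⊆ q = ∀ i → p i ≡ true → q i ≡ true

isYes⇒ : ∀ {P : Set} (P? : Dec P) → isYes P? ≡ true → P
isYes⇒ (yes p) _ = p

⇒isYes : ∀ {P : Set} (P? : Dec P) → P → isYes P? ≡ true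
⇒isYes (yes _) _  = refl
⇒isYes (no ¬p) p = ⊥-elim (¬p p)

¬isYes⇒ : ∀ {P : Set} (P? : Dec P) → isYes P? ≡ false → ¬ P
¬isYes⇒ (no ¬p) _ = ¬p

∧-intro : ∀ {a b} → a ≡ true → b ≡ true → a ∧ b ≡ true
∧-intro refl refl = refl

∧-not-intro : ∀ {a b} → a ≡ true → b ≡ false → a ∧ not b ≡ true
∧-not-intro refl refl = refl

∧-not-elim : ∀ {a b} → a ∧ not b ≡ true → b ≡ false
∧-not-elim {a} {b} e = Boolₚ.not-injective (Boolₚ.∧-conicalʳ a (not b) e)

∧-true-false : ∀ {a b} → a ≡ true → a ∧ b ≡ false → b ≡ false
∧-true-false refl a∧b≡false = a∧b≡false

⁅⁆-self : ∀ {m} (a : Fin m) → ⁅ a ⁆ a ≡ true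
⁅⁆-self a = dec-true (a ≟ a) refl

⁅⁆⇒≡ : ∀ {m} {a i : Fin m} → ⁅ a ⁆ i ≡ true → i ≡ a
⁅⁆⇒≡ {a = a} {i} e with i ≟ a
... | yes i≡a = i≡a

∉⁅⁆⇒≢ : ∀ {m} {a i : Fin m} → ⁅ a ⁆ i ≡ false → i ≢ a
∉⁅⁆⇒≢ {a = a} i∉⁅a⁆ refl with () ← trans (sym (⁅⁆-self a)) i∉⁅a⁆

⁅⁆-separated : ∀ {m} (p : Fin m → Bool) {a i : Fin m} → p a ≡ true → p i ≡ false → ⁅ a ⁆ i ≡ false
⁅⁆-separated p {a} {i} a∈p i∉p with ⁅ a ⁆ i in i∈?⁅a⁆
... | false = refl
... | true with () ← trans (sym a∈p) (subst (λ j → p j ≡ false) (⁅⁆⇒≡ {a = a} {i} i∈?⁅a⁆) i∉p)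

∩-⊆ˡ : ∀ {m} (p q : Fin m → Bool) → p ∩ q ⊆ p
∩-⊆ˡ p q i = Boolₚ.∧-conicalˡ (p i) (q i)

∩-⊆ʳ : ∀ {m} (p q : Fin m → Bool) → p ∩ q ⊆ q
∩-⊆ʳ p q i = Boolₚ.∧-conicalʳ (p i) (q i)

∖-⊆ : ∀ {m} (p q : Fin m → Bool) → p ∖ q ⊆ p
∖-⊆ p q i = Boolₚ.∧-conicalˡ (p i) (not (q i))

∖-monoˡ : ∀ {m} {p q : Fin m → Bool} (r : Fin m → Bool) → p ⊆ q → p ∖ r ⊆ q ∖ r
∖-monoˡ {p = p} r p⊆q i e = ∧-not-intro (p⊆q i (∖-⊆ p r i e)) (∧-not-elim e)

count≡sum : ∀ {m} (p : Fin m → Bool) → count p ≡ sum (λ i → b2n (p i))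
count≡sum {zero}  p = refl
count≡sum {suc m} p = cong (b2n (p zero) +_) (count≡sum (λ i → p (suc i)))

sum-mono : ∀ {m} {f g : Fin m → ℕ} → (∀ i → f i ≤ g i) → sum f ≤ sum g
sum-mono {zero}  f≤g = z≤n
sum-mono {suc m} f≤g = ℕₚ.+-mono-≤ (f≤g zero) (sum-mono (f≤g ∘ suc))

count-cong : ∀ {m} {p q : Fin m → Bool} → (∀ i → p i ≡ q i) → count p ≡ count q
count-cong {zero}  p≗q = refl
count-cong {suc m} p≗q = cong₂ _+_ (cong b2n (p≗q zero)) (count-cong (p≗q ∘ suc))

count-mono : ∀ {m} {p q : Fin m → Bool} → p ⊆ q → count p ≤ count q
count-mono {zero}  p⊆q = z≤n
count-mono {suc m} {p} {q} p⊆q = ℕₚ.+-mono-≤ head (count-mono (p⊆q ∘ suc))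
  where
  head : b2n (p zero) ≤ b2n (q zero)
  head with p zero | p⊆q zero
  ... | false | _   = z≤n
  ... | true  | p⊆q₀ rewrite p⊆q₀ refl = ℕₚ.≤-refl

count-split : ∀ {m} (p q : Fin m → Bool) → count p ≡ count (p ∩ q) + count (p ∖ q)
count-split p q = begin
  count p                                              ≡⟨ count≡sum p ⟩
  sum (λ i → b2n (p i))                                ≡⟨ sum-cong-≗ (λ i → b2n-split (p i) (q i)) ⟩
  sum (λ i → b2n ((p ∩ q) i) + b2n ((p ∖ q) i))
    ≡⟨ ∑-distrib-+ (λ i → b2n ((p ∩ q) i)) (λ i → b2n ((p ∖ q) i)) ⟩
  sum (λ i → b2n ((p ∩ q) i)) + sum (λ i → b2n ((p ∖ q) i))
    ≡⟨ sym (cong₂ _+_ (count≡sum (p ∩ q)) (count≡sum (p ∖ q))) ⟩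
  count (p ∩ q) + count (p ∖ q)                        ∎
  where
  open ≡-Reasoning
  b2n-split : ∀ a b → b2n a ≡ b2n (a ∧ b) + b2n (a ∧ not b)
  b2n-split false _     = refl
  b2n-split true  false = refl
  b2n-split true  true  = refl

count-∪ : ∀ {m} (p q : Fin m → Bool) → count (p ∪ q) ≤ count p + count q
count-∪ p q = begin
  count (p ∪ q)                          ≡⟨ count≡sum (p ∪ q) ⟩
  sum (λ i → b2n ((p ∪ q) i))            ≤⟨ sum-mono (λ i → b2n-∨ (p i) (q i)) ⟩
  sum (λ i → b2n (p i) + b2n (q i))      ≡⟨ ∑-distrib-+ (λ i → b2n (p i)) (λ i → b2n (q i)) ⟩
  sum (λ i → b2n (p i)) + sum (λ i → b2n (q i))
    ≡⟨ sym (cong₂ _+_ (count≡sum p) (count≡sum q)) ⟩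
  count p + count q                      ∎
  where
  open ℕₚ.≤-Reasoning
  b2n-∨ : ∀ a b → b2n (a ∨ b) ≤ b2n a + b2n b
  b2n-∨ false b = ℕₚ.≤-refl
  b2n-∨ true  b = s≤s z≤n

count-∖-triangle : ∀ {m} (p q r : Fin m → Bool) → count (p ∖ r) ≤ count (q ∖ r) + count (p ∖ q)
count-∖-triangle p q r = begin
  count (p ∖ r)                                   ≡⟨ count-split (p ∖ r) q ⟩
  count ((p ∖ r) ∩ q) + count ((p ∖ r) ∖ q)
    ≤⟨ ℕₚ.+-mono-≤ (count-mono inside) (count-mono (∖-monoˡ q (∖-⊆ p r))) ⟩
  count (q ∖ r) + count (p ∖ q)                   ∎
  where
  open ℕₚ.≤-Reasoning
  inside : (p ∖ r) ∩ q ⊆ q ∖ r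
  inside i e = ∧-not-intro (∩-⊆ʳ (p ∖ r) q i e) (∧-not-elim {p i} (∩-⊆ˡ (p ∖ r) q i e))

count-none : ∀ {m} {p : Fin m → Bool} → (∀ i → p i ≡ false) → count p ≡ 0
count-none {zero}  _ = refl
count-none {suc m} {p} p≗false rewrite p≗false zero = count-none (p≗false ∘ suc)

count-⁅⁆ : ∀ {m} (a : Fin m) → count ⁅ a ⁆ ≡ 1
count-⁅⁆ {suc m} zero    = cong suc (count-none {m} {λ i → ⁅ zero ⁆ (suc i)} (λ _ → refl))
count-⁅⁆ {suc m} (suc a) =
  trans (count-cong {p = λ i → ⁅ suc a ⁆ (suc i)} {q = ⁅ a ⁆} (λ _ → refl)) (count-⁅⁆ a)

count≤count∖+count : ∀ {m} (p q : Fin m → Bool) → count p ≤ count (p ∖ q) + count q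
count≤count∖+count p q = begin
  count p                         ≡⟨ count-split p q ⟩
  count (p ∩ q) + count (p ∖ q)   ≤⟨ ℕₚ.+-monoˡ-≤ (count (p ∖ q)) (count-mono (∩-⊆ʳ p q)) ⟩
  count q + count (p ∖ q)         ≡⟨ ℕₚ.+-comm (count q) _ ⟩
  count (p ∖ q) + count q         ∎
  where open ℕₚ.≤-Reasoning

count≤count∖⁅⁆+1 : ∀ {m} (p : Fin m → Bool) (a : Fin m) → count p ≤ count (p ∖ ⁅ a ⁆) + 1
count≤count∖⁅⁆+1 p a = subst (λ k → count p ≤ count (p ∖ ⁅ a ⁆) + k) (count-⁅⁆ a) (count≤count∖+count p ⁅ a ⁆)

∃-∖-of-count< : ∀ {m} (p q : Fin m → Bool) → count q < count p → Σ (Fin m) λ i → p i ≡ true × q i ≡ false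
∃-∖-of-count< p q q<p with any? (λ i → (p i Boolₚ.≟ true) ×-dec (q i Boolₚ.≟ false))
... | yes w = w
... | no ¬w = ⊥-elim (ℕₚ.<⇒≱ q<p (count-mono {p = p} {q} p⊆q))
  where
  p⊆q : p ⊆ q
  p⊆q i e with q i in eq
  ... | true  = refl
  ... | false = ⊥-elim (¬w (i , e , eq))

∃-of-0<count : ∀ {m} (p : Fin m → Bool) → 0 < count p → Σ (Fin m) λ i → p i ≡ true
∃-of-0<count {m} p 0<count =
  let i , i∈p , _ = ∃-∖-of-count< p (λ _ → false) (subst (_< count p) (sym ∅-empty) 0<count) in i , i∈p
  where
  ∅-empty : count {m} (λ _ → false) ≡ 0
  ∅-empty = count-none {m} {λ _ → false} (λ _ → refl)

∃-∩-of-count∖< : ∀ {m} (p q : Fin m → Bool) → count (p ∖ q) < count p → Σ (Fin m) λ i → p i ≡ true × q i ≡ true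
∃-∩-of-count∖< p q h =
  let i , i∈p , i∉p∖q = ∃-∖-of-count< p (p ∖ q) h in i , i∈p , Boolₚ.not-injective (∧-true-false i∈p i∉p∖q)

count*≡sum : ∀ {m} (p : Fin m → Bool) (c : ℕ) → count p * c ≡ sum (λ i → b2n (p i) * c)
count*≡sum p c = trans (cong (_* c) (count≡sum p)) (*-distribʳ-sum c (λ i → b2n (p i)))

double-count : ∀ {m n} (P : Fin m → Fin n → Bool) →
               sum (λ a → count (P a)) ≡ sum (λ b → count (λ a → P a b))
double-count P = begin
  sum (λ a → count (P a))                        ≡⟨ sum-cong-≗ (λ a → count≡sum (P a)) ⟩
  sum (λ a → sum (λ b → b2n (P a b)))            ≡⟨ ∑-comm (λ a b → b2n (P a b)) ⟩
  sum (λ b → sum (λ a → b2n (P a b)))            ≡⟨ sym (sum-cong-≗ (λ b → count≡sum (λ a → P a b))) ⟩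
  sum (λ b → count (λ a → P a b))                ∎
  where open ≡-Reasoning

≤maxF : ∀ {m} (f : Fin m → ℕ) (i : Fin m) → f i ≤ maxF f
≤maxF f zero    = ℕₚ.m≤m⊔n _ _
≤maxF f (suc i) = ℕₚ.≤-trans (≤maxF (f ∘ suc) i) (ℕₚ.m≤n⊔m _ _)

maxF-attained : ∀ {m} (f : Fin (suc m) → ℕ) → Σ (Fin (suc m)) λ i → f i ≡ maxF f
maxF-attained {zero}  f = zero , sym (ℕₚ.⊔-identityʳ (f zero))
maxF-attained {suc m} f with ℕₚ.⊔-sel (f zero) (maxF (f ∘ suc))
... | inj₁ e = zero , sym e
... | inj₂ e with maxF-attained (f ∘ suc)
...   | i , fi≡max = suc i , trans fi≡max (sym e)

∷-injective : ∀ {A : Set} {k} {a : A} {f : Fin k → A} →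
              (∀ i → f i ≢ a) → Injective _≡_ _≡_ f → Injective _≡_ _≡_ (a ∷ f)
∷-injective a∉f f-inj {zero}  {zero}  _ = refl
∷-injective a∉f f-inj {zero}  {suc j} e = ⊥-elim (a∉f j (sym e))
∷-injective a∉f f-inj {suc i} {zero}  e = ⊥-elim (a∉f i e)
∷-injective a∉f f-inj {suc i} {suc j} e = cong suc (f-inj e)

choose : ∀ {m} (p : Fin m → Bool) (s : ℕ) → s ≤ count p →
         Σ (Fin s → Fin m) λ f → Injective _≡_ _≡_ f × (∀ i → p (f i) ≡ true)
choose p zero    _ = (λ ()) , (λ {i} → ⊥-elim (¬Fin0 i)) , (λ ())
choose {zero}  p (suc s) ()
choose {suc m} p (suc s) s<count with p zero in p₀
... | true with choose (p ∘ suc) s (ℕₚ.≤-pred s<count)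
...   | f , f-inj , f∈p = zero ∷ (suc ∘ f) , ∷-injective (λ _ ()) (f-inj ∘ Finₚ.suc-injective) , f∈p′
  where
  f∈p′ : ∀ i → p ((zero ∷ (suc ∘ f)) i) ≡ true
  f∈p′ zero    = p₀
  f∈p′ (suc i) = f∈p i
choose {suc m} p (suc s) s<count | false with choose (p ∘ suc) (suc s) s<count
... | f , f-inj , f∈p = suc ∘ f , f-inj ∘ Finₚ.suc-injective , f∈p

-- Greedy bicliques

-- Averaging: double counting gives Σ_{a ∈ A} |B ∩ R a| ≥ |A| |B| / M.
∃-popular : ∀ {m n} (R : Fin m → Fin n → Bool) (A : Fin m → Bool) (B : Fin n → Bool) (M : ℕ) →
            0 < count A → 0 < count B →
            (∀ b → B b ≡ true → count A ≤ M * count (A ∩ flip R b)) →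
            Σ (Fin m) λ a → A a ≡ true × count B ≤ M * count (B ∩ R a)
∃-popular {zero}  R A B M () _ _
∃-popular {suc m} {n} R A B M A≢∅ B≢∅ A-dense = a* , a*∈A , B-bound
  where
  P : Fin (suc m) → Fin n → Bool
  P a b = B b ∧ (A a ∧ R a b)

  g : Fin (suc m) → ℕ
  g a = count (P a)

  a* : Fin (suc m)
  a* = proj₁ (maxF-attained g)

  g≤ : ∀ a → g a ≤ b2n (A a) * maxF g
  g≤ a = by-cases (A a) refl
    where
    by-cases : ∀ c → A a ≡ c → g a ≤ b2n c * maxF g
    by-cases true  _   = subst (g a ≤_) (sym (ℕₚ.+-identityʳ (maxF g))) (≤maxF g a)
    by-cases false a∉A =
      ℕₚ.≤-reflexive (count-none (λ b → trans (cong (λ z → B b ∧ (z ∧ R a b)) a∉A) (Boolₚ.∧-zeroʳ (B b))))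

  column : ∀ b → b2n (B b) * count A ≤ M * count (λ a → P a b)
  column b with B b in b∈B
  ... | false = z≤n
  ... | true  = subst (_≤ M * count (A ∩ flip R b)) (sym (ℕₚ.+-identityʳ (count A))) (A-dense b b∈B)

  incidences : count B * count A ≤ M * (count A * maxF g)
  incidences = begin
    count B * count A                    ≡⟨ count*≡sum B (count A) ⟩
    sum (λ b → b2n (B b) * count A)      ≤⟨ sum-mono column ⟩
    sum (λ b → M * count (λ a → P a b))  ≡⟨ sym (*-distribˡ-sum M (λ b → count (λ a → P a b))) ⟩
    M * sum (λ b → count (λ a → P a b))  ≡⟨ cong (M *_) (sym (double-count P)) ⟩
    M * sum g                            ≤⟨ ℕₚ.*-monoʳ-≤ M (sum-mono g≤) ⟩
    M * sum (λ a → b2n (A a) * maxF g)   ≡⟨ cong (M *_) (sym (count*≡sum A (maxF g))) ⟩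
    M * (count A * maxF g)               ∎
    where open ℕₚ.≤-Reasoning

  B≤M*max : count B ≤ M * maxF g
  B≤M*max = ℕₚ.*-cancelʳ-≤ (count B) (M * maxF g) (count A) {{ℕ.>-nonZero A≢∅}}
              (subst (count B * count A ≤_) rearrange incidences)
    where
    rearrange : M * (count A * maxF g) ≡ M * maxF g * count A
    rearrange = trans (cong (M *_) (ℕₚ.*-comm (count A) (maxF g))) (sym (ℕₚ.*-assoc M (maxF g) (count A)))

  B≤M*g[a*] : count B ≤ M * g a*
  B≤M*g[a*] = subst (λ k → count B ≤ M * k) (sym (proj₂ (maxF-attained g))) B≤M*max

  a*∈A : A a* ≡ true
  a*∈A with A a* in a*∈?A
  ... | true  = refl
  ... | false = ⊥-elim (ℕₚ.<⇒≱ B≢∅ (ℕₚ.≤-trans B≤M*g[a*] (ℕₚ.≤-trans (ℕₚ.*-monoʳ-≤ M g[a*]≤0) M*0≤0)))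
    where
    M*0≤0 : M * 0 ≤ 0
    M*0≤0 = ℕₚ.≤-reflexive (ℕₚ.*-zeroʳ M)
    g[a*]≤0 : g a* ≤ 0
    g[a*]≤0 = subst (λ c → g a* ≤ b2n c * maxF g) a*∈?A (g≤ a*)

  B-bound : count B ≤ M * count (B ∩ R a*)
  B-bound = ℕₚ.≤-trans B≤M*g[a*] (ℕₚ.*-monoʳ-≤ M (count-mono P⊆))
    where
    P⊆ : P a* ⊆ B ∩ R a*
    P⊆ b e = ∧-intro (Boolₚ.∧-conicalˡ (B b) _ e)
                     (Boolₚ.∧-conicalʳ (A a*) (R a* b) (Boolₚ.∧-conicalʳ (B b) _ e))

record Biclique {m n} (R : Fin m → Fin n → Bool) (A : Fin m → Bool) (B : Fin n → Bool) (k s : ℕ) : Set where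
  field
    left            : Fin k → Fin m
    right           : Fin s → Fin n
    left-injective  : Injective _≡_ _≡_ left
    right-injective : Injective _≡_ _≡_ right
    left⊆A          : ∀ i → A (left i) ≡ true
    right⊆B         : ∀ j → B (right j) ≡ true
    complete        : ∀ i j → R (left i) (right j) ≡ true

module _ {m n} (R : Fin m → Fin n → Bool) where

  -- The slack M·k pays for removing k vertices of A one at a time.
  Dense : ℕ → ℕ → (Fin m → Bool) → (Fin n → Bool) → Set
  Dense M k A B = ∀ b → B b ≡ true → count A + M * k ≤ M * count (A ∩ flip R b)

  biclique-extend : ∀ {A B k s} a → A a ≡ true → Biclique R (A ∖ ⁅ a ⁆) (B ∩ R a) k s → Biclique R A B (suc k) s
  biclique-extend {A} {B} a a∈A K = record
    { left            = a ∷ left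
    ; right           = right
    ; left-injective  = ∷-injective left≢a left-injective
    ; right-injective = right-injective
    ; left⊆A          = λ { zero → a∈A ; (suc i) → ∖-⊆ A ⁅ a ⁆ (left i) (left⊆A i) }
    ; right⊆B         = λ j → ∩-⊆ˡ B (R a) (right j) (right⊆B j)
    ; complete        = λ { zero j → ∩-⊆ʳ B (R a) (right j) (right⊆B j) ; (suc i) j → complete i j }
    }
    where
    open Biclique K
    left≢a : ∀ i → left i ≢ a
    left≢a i = ∉⁅⁆⇒≢ (∧-not-elim {A (left i)} (left⊆A i))

  dense-step : ∀ {M k A B} a → Dense M (suc k) A B → Dense M k (A ∖ ⁅ a ⁆) (B ∩ R a)
  dense-step {M} {k} {A} {B} a dense b b∈B∩Ra = ℕₚ.+-cancelʳ-≤ M _ _ (begin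
    count A′ + M * k + M               ≤⟨ ℕₚ.+-monoˡ-≤ M (ℕₚ.+-monoˡ-≤ (M * k) (count-mono (∖-⊆ A ⁅ a ⁆))) ⟩
    count A + M * k + M                ≡⟨ ℕₚ.+-assoc (count A) (M * k) M ⟩
    count A + (M * k + M)              ≡⟨ cong (count A +_) (trans (ℕₚ.+-comm (M * k) M) (sym (ℕₚ.*-suc M k))) ⟩
    count A + M * suc k                ≤⟨ dense b (∩-⊆ˡ B (R a) b b∈B∩Ra) ⟩
    M * count (A ∩ flip R b)           ≤⟨ ℕₚ.*-monoʳ-≤ M (count≤count∖⁅⁆+1 (A ∩ flip R b) a) ⟩
    M * (count ((A ∩ flip R b) ∖ ⁅ a ⁆) + 1) ≤⟨ ℕₚ.*-monoʳ-≤ M (ℕₚ.+-monoˡ-≤ 1 (count-mono reorder)) ⟩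
    M * (count (A′ ∩ flip R b) + 1)    ≡⟨ ℕₚ.*-distribˡ-+ M _ 1 ⟩
    M * count (A′ ∩ flip R b) + M * 1  ≡⟨ cong (M * count (A′ ∩ flip R b) +_) (ℕₚ.*-identityʳ M) ⟩
    M * count (A′ ∩ flip R b) + M      ∎)
    where
    open ℕₚ.≤-Reasoning
    A′ = A ∖ ⁅ a ⁆
    reorder : (A ∩ flip R b) ∖ ⁅ a ⁆ ⊆ A′ ∩ flip R b
    reorder i e = ∧-intro (∧-not-intro (∩-⊆ˡ A (flip R b) i i∈A∩R) (∧-not-elim {A i ∧ R i b} e))
                          (∩-⊆ʳ A (flip R b) i i∈A∩R)
      where i∈A∩R = ∖-⊆ (A ∩ flip R b) ⁅ a ⁆ i e

  -- k ≤ s only makes s positive while vertices of A remain to be chosen.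
  biclique : (M : ℕ) .{{_ : NonZero M}} (k s : ℕ) → k ≤ s → (A : Fin m → Bool) (B : Fin n → Bool) →
             Dense M k A B → s * M ^ k ≤ count B → Biclique R A B k s
  biclique M zero s _ A B _ s≤|B| with choose B s (subst (_≤ count B) (ℕₚ.*-identityʳ s) s≤|B|)
  ... | f , f-inj , f⊆B = record
    { left = λ () ; right = f ; left-injective = λ {i} → ⊥-elim (¬Fin0 i) ; right-injective = f-inj
    ; left⊆A = λ () ; right⊆B = f⊆B ; complete = λ () }
  biclique M (suc k) s k<s A B dense big
    with ∃-popular R A B M A≢∅ B≢∅ (λ b b∈B → ℕₚ.≤-trans (ℕₚ.m≤m+n (count A) _) (dense b b∈B))
    where
    B≢∅ : 0 < count B
    B≢∅ = ℕₚ.≤-trans (ℕₚ.*-mono-≤ (ℕₚ.≤-trans (s≤s z≤n) k<s) (ℕₚ.m^n>0 M (suc k))) big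
    A≢∅ : 0 < count A
    A≢∅ = let b , b∈B = ∃-of-0<count B B≢∅ in
      ℕₚ.<-≤-trans (ℕₚ.*-cancelˡ-≤ M (ℕₚ.≤-trans (ℕₚ.*-monoʳ-≤ M (s≤s z≤n))
                                       (ℕₚ.≤-trans (ℕₚ.m≤n+m (M * suc k) (count A)) (dense b b∈B))))
                   (count-mono (∩-⊆ˡ A (flip R b)))
  ... | a , a∈A , |B|≤M|B∩Ra| =
    biclique-extend a a∈A (biclique M k s (ℕₚ.<⇒≤ k<s) (A ∖ ⁅ a ⁆) (B ∩ R a) (dense-step {M} {k} a dense) big′)
    where
    big′ : s * M ^ k ≤ count (B ∩ R a)
    big′ = ℕₚ.*-cancelˡ-≤ M (ℕₚ.≤-trans (ℕₚ.≤-reflexive (x∙yz≈y∙xz M s (M ^ k))) (ℕₚ.≤-trans big |B|≤M|B∩Ra|))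

reach-invariant : ∀ {n} (E : BipGraph n) (Q : Vertex E → Set) → (∀ u v → Adj E u v → Q u → Q v) →
                  ∀ {u v} → Reach E u v → Q u → Q v
reach-invariant E Q preserved here       q = q
reach-invariant E Q preserved (step a r) q = reach-invariant E Q preserved r (preserved _ _ a q)

module Transpose {n : ℕ} (E : BipGraph n) where

  swap : Vertex E → Vertex (flip E)
  swap (inj₁ x) = inj₂ x
  swap (inj₂ y) = inj₁ y

  adj-swap : ∀ u v → Adj E u v → Adj (flip E) (swap u) (swap v)
  adj-swap (inj₁ x) (inj₂ y) a = a
  adj-swap (inj₂ y) (inj₁ x) a = a

  reach-swap : ∀ {u v} → Reach E u v → Reach (flip E) (swap u) (swap v)
  reach-swap here       = here
  reach-swap (step a r) = step (adj-swap _ _ a) (reach-swap r)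

  connected : Connected E → Connected (flip E)
  connected c (inj₁ a) (inj₁ b) = reach-swap (c (inj₂ a) (inj₂ b))
  connected c (inj₁ a) (inj₂ b) = reach-swap (c (inj₂ a) (inj₁ b))
  connected c (inj₂ a) (inj₁ b) = reach-swap (c (inj₁ a) (inj₂ b))
  connected c (inj₂ a) (inj₂ b) = reach-swap (c (inj₁ a) (inj₁ b))

  minDegAtLeast : ∀ {k} → MinDegAtLeast E k → MinDegAtLeast (flip E) k
  minDegAtLeast δ≥k (inj₁ y) = δ≥k (inj₂ y)
  minDegAtLeast δ≥k (inj₂ x) = δ≥k (inj₁ x)

  ¬inducedStt : ∀ {t} → ¬ InducedStt E t → ¬ InducedStt (flip E) t
  ¬inducedStt ¬S S = ¬S record
    { x = y ; y = x ; xs = ys ; ys = xs ; xs-inj = ys-inj ; ys-inj = xs-inj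
    ; x≢xs = y≢ys ; y≢ys = x≢xs ; e-xy = e-xy ; e-xyᵢ = e-yxᵢ ; e-yxᵢ = e-xyᵢ
    ; no-xᵢyⱼ = λ i j → no-xᵢyⱼ j i }
    where open InducedStt S

module Sparse {n : ℕ} (E : BipGraph n) (M t : ℕ) where

  sparse : Fin n → Fin n → Fin n → Bool
  sparse x y b = (E x ∖ ⁅ y ⁆) b ∧
                 isYes (count (flip E y ∖ ⁅ x ⁆) + M * t ≤? M * count ((flip E y ∖ ⁅ x ⁆) ∖ flip E b))

  sparse⊆ : ∀ x y → sparse x y ⊆ E x ∖ ⁅ y ⁆
  sparse⊆ x y b = Boolₚ.∧-conicalˡ ((E x ∖ ⁅ y ⁆) b) _

  -- t·Mᵗ sparse vertices contain a t × t anti-biclique between N(y) ∖ {x} and N(x) ∖ {y}.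
  sparse-few : .{{_ : NonZero M}} → ¬ InducedStt E t → ∀ {x y} → E x y ≡ true → count (sparse x y) < t * M ^ t
  sparse-few ¬S {x} {y} xy with t * M ^ t ≤? count (sparse x y)
  ... | no  few  = ℕₚ.≰⇒> few
  ... | yes many = ⊥-elim (¬S (record
    { x = x ; y = y ; xs = left ; ys = right
    ; xs-inj = left-injective ; ys-inj = right-injective
    ; x≢xs = λ i → ≢-sym (∉⁅⁆⇒≢ (∧-not-elim {E (left i) y} (left⊆A i)))
    ; y≢ys = λ j → ≢-sym (∉⁅⁆⇒≢ (∧-not-elim {E x (right j)} (sparse⊆ x y (right j) (right⊆B j))))
    ; e-xy = xy
    ; e-xyᵢ = λ j → ∖-⊆ (E x) ⁅ y ⁆ (right j) (sparse⊆ x y (right j) (right⊆B j))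
    ; e-yxᵢ = λ i → ∖-⊆ (flip E y) ⁅ x ⁆ (left i) (left⊆A i)
    ; no-xᵢyⱼ = λ i j → Boolₚ.not-injective (complete i j) }))
    where
    K = biclique (λ a b → not (E a b)) M t t ℕₚ.≤-refl (flip E y ∖ ⁅ x ⁆) (sparse x y)
          (λ b b∈sparse → isYes⇒ _ (Boolₚ.∧-conicalʳ ((E x ∖ ⁅ y ⁆) b) _ b∈sparse)) many
    open Biclique K

≤-by : ∀ {a b} w → b ≡ a + w → a ≤ b
≤-by {a} w b≡a+w = subst (a ≤_) (sym b≡a+w) (ℕₚ.m≤m+n a w)

-- Each inequality is proved by exhibiting the difference of its two sides as a polynomial.
module DegreeBound (k t m : ℕ) where

  M C : ℕ
  M = 4 + m
  C = M * (k + 2 * t + 4)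

  L B₁ B₂ : ℕ → ℕ
  L  Δ = Δ + M * t
  B₁ Δ = L Δ + M
  B₂ Δ = L Δ + (B₁ Δ + M)

  k+k≤C : k + k ≤ C
  k+k≤C = ≤-by (2 * k + 8 * t + 16 + m * (k + 2 * t + 4)) (identity k t m)
    where
    identity : ∀ k t m → (4 + m) * (k + 2 * t + 4) ≡ (k + k) + (2 * k + 8 * t + 16 + m * (k + 2 * t + 4))
    identity = solve-∀

  k+2≤ : ∀ {Δ} → C ≤ Δ → k + 2 ≤ Δ
  k+2≤ C≤Δ with ℕₚ.m≤n⇒∃[o]m+o≡n C≤Δ
  ... | e , refl = ≤-by (3 * k + 8 * t + 14 + m * (k + 2 * t + 4) + e) (identity k t m e)
    where
    identity : ∀ k t m e → (4 + m) * (k + 2 * t + 4) + e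
                           ≡ (k + 2) + (3 * k + 8 * t + 14 + m * (k + 2 * t + 4) + e)
    identity = solve-∀

  B₂<4*Δ : ∀ {Δ} → C ≤ Δ → B₂ Δ < 4 * Δ
  B₂<4*Δ C≤Δ with ℕₚ.m≤n⇒∃[o]m+o≡n C≤Δ
  ... | e , refl = ≤-by (3 + m + (4 + m) * (2 * k + 2 * t + 5) + 2 * e) (identity k t m e)
    where
    identity : ∀ k t m e → let Δ = (4 + m) * (k + 2 * t + 4) + e in
               4 * Δ ≡ suc ((Δ + (4 + m) * t) + ((Δ + (4 + m) * t + (4 + m)) + (4 + m)))
                       + (3 + m + (4 + m) * (2 * k + 2 * t + 5) + 2 * e)
    identity = solve-∀

  M*[k+1]+B₂<M*Δ : ∀ {Δ} → C ≤ Δ → M * (k + 1) + B₂ Δ < M * Δ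
  M*[k+1]+B₂<M*Δ C≤Δ with ℕₚ.m≤n⇒∃[o]m+o≡n C≤Δ
  ... | e , refl = ≤-by (3 + m + (4 + m) * ((1 + m) * (k + 2 * t + 4)) + (2 + m) * e) (identity k t m e)
    where
    identity : ∀ k t m e → let Δ = (4 + m) * (k + 2 * t + 4) + e in
               (4 + m) * Δ ≡ suc ((4 + m) * (k + 1)
                                  + ((Δ + (4 + m) * t) + ((Δ + (4 + m) * t + (4 + m)) + (4 + m))))
                             + (3 + m + (4 + m) * ((1 + m) * (k + 2 * t + 4)) + (2 + m) * e)
    identity = solve-∀

  M*k+α+M*t≤M*α : ∀ {α} → C ≤ α + 1 → M * k + α + M * t ≤ M * α
  M*k+α+M*t≤M*α {α} C≤α+1 with ℕₚ.m≤n⇒∃[o]m+o≡n C≤α+1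
  ... | e , C+e≡α+1 = subst (λ a → M * k + a + M * t ≤ M * a) α≡ (≤-by _ (identity k t m e))
    where
    α≡ : 15 + 4 * k + 8 * t + m * (k + 2 * t + 4) + e ≡ α
    α≡ = ℕₚ.suc-injective (trans (cong (_+ e) (C≡ k t m)) (trans C+e≡α+1 (ℕₚ.+-comm α 1)))
      where
      C≡ : ∀ k t m → suc (15 + 4 * k + 8 * t + m * (k + 2 * t + 4)) ≡ (4 + m) * (k + 2 * t + 4)
      C≡ = solve-∀
    identity : ∀ k t m e → let α = 15 + 4 * k + 8 * t + m * (k + 2 * t + 4) + e in
               (4 + m) * α ≡ ((4 + m) * k + α + (4 + m) * t)
                 + (45 + 8 * k + 20 * t + 6 * m * k + 13 * m * t + 27 * m
                    + m * m * k + 2 * m * m * t + 4 * m * m + (3 + m) * e)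
    identity = solve-∀

degreeBound : ℕ → ℕ → ℕ
degreeBound t m = DegreeBound.C (t * (4 + m) ^ t) t m

-- The main argument

module Concentration {n : ℕ} (E : BipGraph n) (t m : ℕ) (¬Stt : ¬ InducedStt E t)
                     (δ≥C : MinDegAtLeast E (degreeBound t m))
                     (y₀ : Fin n) (y₀-max : degY E y₀ ≡ ΔY E) where

  K Δ : ℕ
  K = t * (4 + m) ^ t
  Δ = ΔY E

  open DegreeBound K t m
  open Sparse E M t using () renaming (sparse to sparseY; sparse-few to sparseY-few)
  open Sparse (flip E) M t using () renaming (sparse to sparseXᵀ; sparse-few to sparseXᵀ-few)

  S : Fin n → Bool
  S = flip E y₀

  miss hit : Fin n → ℕ
  miss y = count (S ∖ flip E y)
  hit  y = count (S ∩ flip E y)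

  Near₁ Near₂ Rich : Fin n → Bool
  Near₁ y = isYes (M * miss y ≤? B₁ Δ)
  Near₂ y = isYes (M * miss y ≤? B₂ Δ)
  Rich  y = isYes (K + 2 ≤? hit y)

  C≤Δ : C ≤ Δ
  C≤Δ = ℕₚ.≤-trans (δ≥C (inj₂ y₀)) (ℕₚ.≤-reflexive y₀-max)

  degY≤Δ : ∀ y → degY E y ≤ Δ
  degY≤Δ = ≤maxF (degY E)

  hit+miss : ∀ y → hit y + miss y ≡ Δ
  hit+miss y = trans (sym (count-split S (flip E y))) y₀-max

  miss-y₀ : miss y₀ ≡ 0
  miss-y₀ = count-none (λ a → Boolₚ.∧-inverseʳ (E a y₀))

  near₁-y₀ : Near₁ y₀ ≡ true
  near₁-y₀ = ⇒isYes (M * miss y₀ ≤? B₁ Δ)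
    (subst (_≤ B₁ Δ) (sym (trans (cong (M *_) miss-y₀) (ℕₚ.*-zeroʳ M))) z≤n)

  near₁⇒near₂ : ∀ y → Near₁ y ≡ true → Near₂ y ≡ true
  near₁⇒near₂ y near = ⇒isYes (M * miss y ≤? B₂ Δ)
    (ℕₚ.≤-trans (isYes⇒ (M * miss y ≤? B₁ Δ) near) (ℕₚ.≤-trans (ℕₚ.m≤m+n (B₁ Δ) M) (ℕₚ.m≤n+m (B₁ Δ + M) (L Δ))))

  near₂⇒rich : ∀ y → Near₂ y ≡ true → Rich y ≡ true
  near₂⇒rich y near = ⇒isYes (K + 2 ≤? hit y) (subst (_≤ hit y) (sym (ℕₚ.+-suc K 1))
    (ℕₚ.*-cancelˡ-< M (K + 1) (hit y) (ℕₚ.+-cancelʳ-< (B₂ Δ) _ _ (ℕₚ.<-≤-trans (M*[k+1]+B₂<M*Δ C≤Δ) MΔ≤))))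
    where
    MΔ≤ : M * Δ ≤ M * hit y + B₂ Δ
    MΔ≤ = begin
      M * Δ                       ≡⟨ cong (M *_) (sym (hit+miss y)) ⟩
      M * (hit y + miss y)        ≡⟨ ℕₚ.*-distribˡ-+ M (hit y) (miss y) ⟩
      M * hit y + M * miss y      ≤⟨ ℕₚ.+-monoʳ-≤ (M * hit y) (isYes⇒ (M * miss y ≤? B₂ Δ) near) ⟩
      M * hit y + B₂ Δ            ∎
      where open ℕₚ.≤-Reasoning

  -- Every b ∉ T adjacent to x is sparse for xy: N(y) ∖ {x} and S differ in at most miss y + 1 vertices.
  few-far : ∀ {x y} → E x y ≡ true → (T : Fin n → Bool) → T y ≡ true →
            (∀ b → T b ≡ false → L Δ + M * (miss y + 1) < M * miss b) → count (E x ∖ T) < K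
  few-far {x} {y} xy T y∈T far = ℕₚ.≤-<-trans (count-mono far⊆sparse) (sparseY-few ¬Stt xy)
    where
    A : Fin n → Bool
    A = flip E y ∖ ⁅ x ⁆

    S∖A⊆ : S ∖ A ⊆ (S ∖ flip E y) ∪ ⁅ x ⁆
    S∖A⊆ a = by-cases (S a) (E a y) (⁅ x ⁆ a)
      where
      by-cases : ∀ s e d → s ∧ not (e ∧ not d) ≡ true → (s ∧ not e) ∨ d ≡ true
      by-cases true false _    _ = refl
      by-cases true true  true _ = refl

    S∖A≤ : count (S ∖ A) ≤ miss y + 1
    S∖A≤ = ℕₚ.≤-trans (count-mono S∖A⊆)
             (subst (count ((S ∖ flip E y) ∪ ⁅ x ⁆) ≤_) (cong (miss y +_) (count-⁅⁆ x))
                    (count-∪ (S ∖ flip E y) ⁅ x ⁆))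

    L<M*count : ∀ b → T b ≡ false → L Δ < M * count (A ∖ flip E b)
    L<M*count b b∉T = ℕₚ.+-cancelʳ-< (M * (miss y + 1)) (L Δ) _ (begin-strict
      L Δ + M * (miss y + 1)                    <⟨ far b b∉T ⟩
      M * miss b                                ≤⟨ ℕₚ.*-monoʳ-≤ M (count-∖-triangle S A (flip E b)) ⟩
      M * (count (A ∖ flip E b) + count (S ∖ A))
        ≡⟨ ℕₚ.*-distribˡ-+ M (count (A ∖ flip E b)) (count (S ∖ A)) ⟩
      M * count (A ∖ flip E b) + M * count (S ∖ A)
        ≤⟨ ℕₚ.+-monoʳ-≤ (M * count (A ∖ flip E b)) (ℕₚ.*-monoʳ-≤ M S∖A≤) ⟩
      M * count (A ∖ flip E b) + M * (miss y + 1) ∎)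
      where open ℕₚ.≤-Reasoning

    |A|+Mt≤L : count A + M * t ≤ L Δ
    |A|+Mt≤L = ℕₚ.+-monoˡ-≤ (M * t) (ℕₚ.≤-trans (count-mono (∖-⊆ (flip E y) ⁅ x ⁆)) (degY≤Δ y))

    far⊆sparse : E x ∖ T ⊆ sparseY x y
    far⊆sparse b e = ∧-intro (∧-not-intro (∖-⊆ (E x) T b e) (⁅⁆-separated T y∈T b∉T))
                             (⇒isYes _ (ℕₚ.<⇒≤ (ℕₚ.≤-<-trans |A|+Mt≤L (L<M*count b b∉T))))
      where
      b∉T = ∧-not-elim {E x b} e

  far₁-few : ∀ {a} → S a ≡ true → count (E a ∖ Near₁) < K
  far₁-few {a} a∈S = few-far a∈S Near₁ near₁-y₀ far
    where
    far : ∀ b → Near₁ b ≡ false → L Δ + M * (miss y₀ + 1) < M * miss b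
    far b b∉Near₁ = subst (_< M * miss b) (sym B₁-form) (ℕₚ.≰⇒> (¬isYes⇒ (M * miss b ≤? B₁ Δ) b∉Near₁))
      where
      B₁-form : L Δ + M * (miss y₀ + 1) ≡ B₁ Δ
      B₁-form = trans (cong (λ k → L Δ + M * (k + 1)) miss-y₀) (cong (L Δ +_) (ℕₚ.*-identityʳ M))

  far₂-few : ∀ {x y} → E x y ≡ true → Near₁ y ≡ true → count (E x ∖ Near₂) < K
  far₂-few {x} {y} xy y∈Near₁ = few-far xy Near₂ (near₁⇒near₂ y y∈Near₁) far
    where
    far : ∀ b → Near₂ b ≡ false → L Δ + M * (miss y + 1) < M * miss b
    far b b∉Near₂ = ℕₚ.≤-<-trans (ℕₚ.+-monoʳ-≤ (L Δ) M[miss+1]≤) (ℕₚ.≰⇒> (¬isYes⇒ (M * miss b ≤? B₂ Δ) b∉Near₂))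
      where
      M[miss+1]≤ : M * (miss y + 1) ≤ B₁ Δ + M
      M[miss+1]≤ = begin
        M * (miss y + 1)      ≡⟨ ℕₚ.*-distribˡ-+ M (miss y) 1 ⟩
        M * miss y + M * 1    ≡⟨ cong (M * miss y +_) (ℕₚ.*-identityʳ M) ⟩
        M * miss y + M        ≤⟨ ℕₚ.+-monoˡ-≤ M (isYes⇒ (M * miss y ≤? B₁ Δ) y∈Near₁) ⟩
        B₁ Δ + M              ∎
        where open ℕₚ.≤-Reasoning

  -- Not being sparse for (u, y), v sees all but a 1/M share of N(u) ∖ {y}: more than K vertices.
  common-neighbour : ∀ {u v y} → E u y ≡ true → (flip E y ∖ ⁅ u ⁆) v ≡ true → sparseXᵀ y u v ≡ false →
                     (T : Fin n → Bool) → count ((E u ∩ E v) ∖ T) < K →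
                     Σ (Fin n) λ y′ → (E u ∩ E v) y′ ≡ true × T y′ ≡ true
  common-neighbour {u} {v} {y} uy v∈N∖u v∉sparse T few = ∃-∩-of-count∖< (E u ∩ E v) T (ℕₚ.<-trans few K<codeg)
    where
    A : Fin n → Bool
    A = E u ∖ ⁅ y ⁆

    Mmiss<α+Mt : M * count (A ∖ E v) < count A + M * t
    Mmiss<α+Mt = ℕₚ.≰⇒> (¬isYes⇒ (count A + M * t ≤? M * count (A ∖ E v)) (∧-true-false v∈N∖u v∉sparse))

    C≤α+1 : C ≤ count A + 1
    C≤α+1 = ℕₚ.≤-trans (δ≥C (inj₁ u)) (count≤count∖⁅⁆+1 (E u) y)

    K<codeg : K < count (E u ∩ E v)
    K<codeg = ℕₚ.<-≤-trans (ℕₚ.*-cancelˡ-< M K _ (ℕₚ.+-cancelʳ-< (M * count (A ∖ E v)) (M * K) _ (begin-strict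
      M * K + M * count (A ∖ E v)                <⟨ ℕₚ.+-monoʳ-< (M * K) Mmiss<α+Mt ⟩
      M * K + (count A + M * t)                  ≡⟨ sym (ℕₚ.+-assoc (M * K) (count A) (M * t)) ⟩
      M * K + count A + M * t                    ≤⟨ M*k+α+M*t≤M*α C≤α+1 ⟩
      M * count A                                ≡⟨ cong (M *_) (count-split A (E v)) ⟩
      M * (count (A ∩ E v) + count (A ∖ E v))    ≡⟨ ℕₚ.*-distribˡ-+ M (count (A ∩ E v)) (count (A ∖ E v)) ⟩
      M * count (A ∩ E v) + M * count (A ∖ E v)  ∎)))
      (count-mono (λ b e → ∧-intro (∖-⊆ (E u) ⁅ y ⁆ b (∩-⊆ˡ A (E v) b e)) (∩-⊆ʳ A (E v) b e)))
      where open ℕₚ.≤-Reasoning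

  near₁-neighbour : ∀ {x y} → E x y ≡ true → Rich y ≡ true → Σ (Fin n) λ y′ → E x y′ ≡ true × Near₁ y′ ≡ true
  near₁-neighbour {x} {y} xy rich =
    through (∃-∖-of-count< p (sparseXᵀ y x) (ℕₚ.<-trans (sparseXᵀ-few ¬Sttᵀ xy) K<p))
    where
    ¬Sttᵀ = Transpose.¬inducedStt E ¬Stt

    p : Fin n → Bool
    p = (S ∩ flip E y) ∖ ⁅ x ⁆

    K<p : K < count p
    K<p = subst (_≤ count p) (ℕₚ.+-comm K 1) (ℕₚ.+-cancelʳ-≤ 1 (K + 1) (count p)
            (ℕₚ.≤-trans (ℕₚ.≤-reflexive (ℕₚ.+-assoc K 1 1))
              (ℕₚ.≤-trans (isYes⇒ (K + 2 ≤? hit y) rich) (count≤count∖⁅⁆+1 (S ∩ flip E y) x))))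

    through : (Σ (Fin n) λ s → p s ≡ true × sparseXᵀ y x s ≡ false) →
              Σ (Fin n) λ y′ → E x y′ ≡ true × Near₁ y′ ≡ true
    through (s , s∈p , s∉sparse) =
      let y′ , y′∈Nx∩Ns , near = common-neighbour xy s∈N∖x s∉sparse Near₁ few
      in y′ , ∩-⊆ˡ (E x) (E s) y′ y′∈Nx∩Ns , near
      where
      s∈S∩N : (S ∩ flip E y) s ≡ true
      s∈S∩N = ∖-⊆ (S ∩ flip E y) ⁅ x ⁆ s s∈p
      s∈N∖x : (flip E y ∖ ⁅ x ⁆) s ≡ true
      s∈N∖x = ∧-not-intro (∩-⊆ʳ S (flip E y) s s∈S∩N) (∧-not-elim {(S ∩ flip E y) s} s∈p)
      few : count ((E x ∩ E s) ∖ Near₁) < K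
      few = ℕₚ.≤-<-trans (count-mono (∖-monoˡ Near₁ (∩-⊆ʳ (E x) (E s))))
                         (far₁-few (∩-⊆ˡ S (flip E y) s s∈S∩N))

  Good : Fin n → Set
  Good x = Σ (Fin n) λ y → E x y ≡ true × Rich y ≡ true

  good⇒far₂-few : ∀ {x} → Good x → count (E x ∖ Near₂) < K
  good⇒far₂-few (y , xy , rich) = let y′ , xy′ , near = near₁-neighbour xy rich in far₂-few xy′ near

  -- Join x and x′ through some a ∈ N(y) ∖ {x′} that is sparse for neither; then Good x ⇒ Good a ⇒ Good x′.
  good-spreads : ∀ {x x′ y} → Good x → E x y ≡ true → E x′ y ≡ true → Good x′
  good-spreads {x} {x′} {y} good-x xy x′y = through (∃-∖-of-count< p q q<p)
    where
    ¬Sttᵀ = Transpose.¬inducedStt E ¬Stt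

    p q : Fin n → Bool
    p = flip E y ∖ ⁅ x′ ⁆
    q = sparseXᵀ y x ∪ sparseXᵀ y x′

    q<p : count q < count p
    q<p = ℕₚ.≤-<-trans (count-∪ (sparseXᵀ y x) (sparseXᵀ y x′)) (ℕₚ.≤-pred (begin
      suc (suc (c + c′))          ≡⟨ cong suc (sym (ℕₚ.+-suc c c′)) ⟩
      suc c + suc c′              ≤⟨ ℕₚ.+-mono-≤ (sparseXᵀ-few ¬Sttᵀ xy) (sparseXᵀ-few ¬Sttᵀ x′y) ⟩
      K + K                       ≤⟨ k+k≤C ⟩
      C                           ≤⟨ δ≥C (inj₂ y) ⟩
      count (flip E y)            ≤⟨ count≤count∖⁅⁆+1 (flip E y) x′ ⟩
      count p + 1                 ≡⟨ ℕₚ.+-comm (count p) 1 ⟩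
      suc (count p)               ∎))
      where
      open ℕₚ.≤-Reasoning
      c  = count (sparseXᵀ y x)
      c′ = count (sparseXᵀ y x′)

    through : (Σ (Fin n) λ a → p a ≡ true × q a ≡ false) → Good x′
    through (a , a∈p , a∉q) = spread x′y a∈p (Boolₚ.∨-conicalʳ _ _ a∉q) good-a
      where
      spread : ∀ {u} → E u y ≡ true → (flip E y ∖ ⁅ u ⁆) a ≡ true → sparseXᵀ y u a ≡ false → Good a → Good u
      spread {u} uy a∈N∖u a∉sparse good =
        let y′ , y′∈Nu∩Na , near = common-neighbour uy a∈N∖u a∉sparse Near₂
              (ℕₚ.≤-<-trans (count-mono (∖-monoˡ Near₂ (∩-⊆ʳ (E u) (E a)))) (good⇒far₂-few good))
        in y′ , ∩-⊆ˡ (E u) (E a) y′ y′∈Nu∩Na , near₂⇒rich y′ near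

      good-a : Good a
      good-a = by-cases (a ≟ x)
        where
        by-cases : Dec (a ≡ x) → Good a
        by-cases (yes refl) = good-x
        by-cases (no a≢x)   =
          let a∈N∖x = ∧-not-intro (∖-⊆ (flip E y) ⁅ x′ ⁆ a a∈p) (dec-false (a ≟ x) a≢x)
              y′ , y′∈Nx∩Na , near = common-neighbour xy a∈N∖x (Boolₚ.∨-conicalˡ _ _ a∉q) Near₂
                (ℕₚ.≤-<-trans (count-mono (∖-monoˡ Near₂ (∩-⊆ˡ (E x) (E a)))) (good⇒far₂-few good-x))
          in y′ , ∩-⊆ʳ (E x) (E a) y′ y′∈Nx∩Na , near₂⇒rich y′ near

  rich-y₀ : Rich y₀ ≡ true
  rich-y₀ = ⇒isYes (K + 2 ≤? hit y₀) (subst (K + 2 ≤_) hit-y₀ (k+2≤ C≤Δ))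
    where
    hit-y₀ : Δ ≡ hit y₀
    hit-y₀ = sym (trans (count-cong (λ a → Boolₚ.∧-idem (E a y₀))) y₀-max)

  all-good : Connected E → ∀ x → Good x
  all-good connected x = reach-invariant E Q preserved (connected (inj₁ x₀) (inj₁ x)) (y₀ , x₀∈S , rich-y₀)
    where
    x₀∈S-exists : Σ (Fin n) λ x₀ → S x₀ ≡ true
    x₀∈S-exists = ∃-of-0<count S
      (subst (0 <_) (sym y₀-max) (ℕₚ.<-≤-trans (s≤s z≤n) (ℕₚ.≤-trans (ℕₚ.m≤n+m 2 K) (k+2≤ C≤Δ))))
    x₀ = proj₁ x₀∈S-exists
    x₀∈S = proj₂ x₀∈S-exists
    Q : Vertex E → Set
    Q (inj₁ x) = Good x
    Q (inj₂ y) = Σ (Fin n) λ x → Good x × E x y ≡ true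
    preserved : ∀ u v → Adj E u v → Q u → Q v
    preserved (inj₁ x) (inj₂ y) xy good            = x , good , xy
    preserved (inj₂ y) (inj₁ x′) x′y (x , good , xy) = good-spreads good xy x′y

  -- A low vertex misses at least 4Δ/M vertices of S, which is more than B₂ Δ / M.
  low⇒far₂ : ∀ y → M * degY E y + 4 * Δ ≤ M * Δ → Near₂ y ≡ false
  low⇒far₂ y low with Near₂ y in y∈?Near₂
  ... | false = refl
  ... | true  = ⊥-elim (ℕₚ.<⇒≱ (B₂<4*Δ C≤Δ) (ℕₚ.+-cancelˡ-≤ (M * degY E y) _ _ (begin
    M * degY E y + 4 * Δ        ≤⟨ low ⟩
    M * Δ                       ≡⟨ cong (M *_) (sym (hit+miss y)) ⟩
    M * (hit y + miss y)        ≡⟨ ℕₚ.*-distribˡ-+ M (hit y) (miss y) ⟩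
    M * hit y + M * miss y      ≤⟨ ℕₚ.+-mono-≤ (ℕₚ.*-monoʳ-≤ M (count-mono (∩-⊆ʳ S (flip E y))))
                                               (isYes⇒ (M * miss y ≤? B₂ Δ) y∈?Near₂) ⟩
    M * degY E y + B₂ Δ         ∎)))
    where open ℕₚ.≤-Reasoning

  few-low-neighbours : Connected E → (U : Fin n → Bool) → (∀ y → U y ≡ true → M * degY E y + 4 * Δ ≤ M * Δ) →
                       ∀ x → count (E x ∩ U) < K
  few-low-neighbours connected U low x =
    ℕₚ.≤-<-trans (count-mono low⊆far₂) (good⇒far₂-few (all-good connected x))
    where
    low⊆far₂ : E x ∩ U ⊆ E x ∖ Near₂
    low⊆far₂ y e = ∧-not-intro (∩-⊆ˡ (E x) U y e) (low⇒far₂ y (low y (∩-⊆ʳ (E x) U y e)))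

-- Rational thresholds, in a module of their own because ℤ's prefix +_ clashes with sections of ℕ's _+_.
module Fraction where

  open import Data.Integer as ℤ using (+_; -[1+_]; +[1+_])
  import Data.Integer.Properties as ℤₚ
  open import Data.Integer.Tactic.RingSolver using () renaming (solve-∀ to ℤ-solve-∀)
  open import Data.Rational using (mkℚ; _/_; ↧ₙ_; toℚᵘ)
  open import Data.Rational.Unnormalised as ℚᵘ using (mkℚᵘ; 1ℚᵘ; *≤*)
  import Data.Rational.Unnormalised.Properties as ℚᵘₚ
  open import Data.Nat.Coprimality using (1-coprimeTo) renaming (sym to coprime-sym)

  ℕ→ℚᵘ : ∀ k → toℚᵘ (+ k / 1) ≡ mkℚᵘ (+ k) 0
  ℕ→ℚᵘ k = cong toℚᵘ (ℚₚ.normalize-coprime (coprime-sym (1-coprimeTo k)))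

  -- The order on ℚᵘ unfolds to the cross-multiplied integer inequality d·↧ε ≤ (↧ε - ↥ε)·Δ.
  cross-multiply : ∀ p q d Δ → mkℚᵘ (+ d) 0 ℚᵘ.≤ (1ℚᵘ ℚᵘ.- mkℚᵘ +[1+ p ] q) ℚᵘ.* mkℚᵘ (+ Δ) 0 →
                   suc q * d + suc p * Δ ≤ suc q * Δ
  cross-multiply p q d Δ (*≤* h) =
    ℤₚ.drop‿+≤+ (subst₂ ℤ._≤_ lhs (sym (ℤₚ.pos-* (suc q) Δ)) (shift (+ d) (+ suc q) (+ suc p) (+ Δ) h′))
    where
    h′ : + d ℤ.* + suc q ℤ.≤ ((+ 1 ℤ.* + suc q ℤ.+ ℤ.- (+ suc p) ℤ.* + 1) ℤ.* + Δ) ℤ.* + 1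
    h′ = subst (λ k → + d ℤ.* + k ℤ.≤ ((+ 1 ℤ.* + suc q ℤ.+ ℤ.- (+ suc p) ℤ.* + 1) ℤ.* + Δ) ℤ.* + 1)
               (trans (ℕₚ.*-identityʳ (1 * suc q)) (ℕₚ.*-identityˡ (suc q))) h
    identity : ∀ Q P Δ → ((+ 1 ℤ.* Q ℤ.+ ℤ.- P ℤ.* + 1) ℤ.* Δ) ℤ.* + 1 ℤ.+ P ℤ.* Δ ≡ Q ℤ.* Δ
    identity = ℤ-solve-∀
    shift : ∀ D Q P Δ → D ℤ.* Q ℤ.≤ ((+ 1 ℤ.* Q ℤ.+ ℤ.- P ℤ.* + 1) ℤ.* Δ) ℤ.* + 1 →
                        D ℤ.* Q ℤ.+ P ℤ.* Δ ℤ.≤ Q ℤ.* Δ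
    shift D Q P Δ h = subst (D ℤ.* Q ℤ.+ P ℤ.* Δ ℤ.≤_) (identity Q P Δ) (ℤₚ.+-monoˡ-≤ (P ℤ.* Δ) h)
    lhs : + d ℤ.* + suc q ℤ.+ + suc p ℤ.* + Δ ≡ + (suc q * d + suc p * Δ)
    lhs = trans (cong₂ ℤ._+_ (trans (sym (ℤₚ.pos-* d (suc q))) (cong +_ (ℕₚ.*-comm d (suc q))))
                             (sym (ℤₚ.pos-* (suc p) Δ)))
                (sym (ℤₚ.pos-+ (suc q * d) (suc p * Δ)))

  below-fraction : ∀ ε → 0ℚ ℚ.< ε → ∀ d Δ → + d / 1 ℚ.≤ (1ℚ ℚ.- ε) ℚ.* (+ Δ / 1) → ↧ₙ ε * d + Δ ≤ ↧ₙ ε * Δ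
  below-fraction (mkℚ (+ 0) _ _)       (ℚ.*<* (ℤ.+<+ ()))
  below-fraction (mkℚ -[1+ _ ] _ _)    (ℚ.*<* ())
  below-fraction ε@(mkℚ +[1+ p ] q _) _ d Δ d≤ =
    ℕₚ.≤-trans (ℕₚ.+-monoʳ-≤ (suc q * d) (ℕₚ.m≤n*m Δ (suc p))) (cross-multiply p q d Δ unnormalised)
    where
    homomorphic : toℚᵘ ((1ℚ ℚ.- ε) ℚ.* (+ Δ / 1)) ℚᵘ.≃ (1ℚᵘ ℚᵘ.- toℚᵘ ε) ℚᵘ.* toℚᵘ (+ Δ / 1)
    homomorphic = ℚᵘₚ.≃-trans (ℚₚ.toℚᵘ-homo-* (1ℚ ℚ.- ε) (+ Δ / 1))
                    (ℚᵘₚ.*-congʳ (ℚᵘₚ.≃-trans (ℚₚ.toℚᵘ-homo-+ 1ℚ (ℚ.- ε)) (ℚᵘₚ.+-congʳ 1ℚᵘ (ℚₚ.toℚᵘ-homo‿- ε))))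
    unnormalised : mkℚᵘ (+ d) 0 ℚᵘ.≤ (1ℚᵘ ℚᵘ.- mkℚᵘ +[1+ p ] q) ℚᵘ.* mkℚᵘ (+ Δ) 0
    unnormalised = subst₂ (λ a b → a ℚᵘ.≤ (1ℚᵘ ℚᵘ.- toℚᵘ ε) ℚᵘ.* b) (ℕ→ℚᵘ d) (ℕ→ℚᵘ Δ)
                     (ℚᵘₚ.≤-respʳ-≃ homomorphic (ℚₚ.toℚᵘ-mono-≤ d≤))

open Fraction using (below-fraction)

scale-by-4 : ∀ q d Δ → suc q * d + Δ ≤ suc q * Δ → (4 + 4 * q) * d + 4 * Δ ≤ (4 + 4 * q) * Δ
scale-by-4 q d Δ h = subst₂ _≤_ (lhs q d Δ) (rhs q Δ) (ℕₚ.*-monoʳ-≤ 4 h)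
  where
  lhs : ∀ q d Δ → 4 * (suc q * d + Δ) ≡ (4 + 4 * q) * d + 4 * Δ
  lhs = solve-∀
  rhs : ∀ q Δ → 4 * (suc q * Δ) ≡ (4 + 4 * q) * Δ
  rhs = solve-∀

-- M = 4 + 4·(↧ε - 1) = 4·↧ε, so that ε ≥ 1/↧ε = 4/M.
C₆ : ℕ → ℚ → ℕ
C₆ t ε = degreeBound t (4 * ℚ.denominator-1 ε)

dUY≤C₆ : ∀ t ε → 0ℚ ℚ.< ε → ∀ n (E : BipGraph n) → Connected E → MinDegAtLeast E (C₆ t ε) → ¬ InducedStt E t →
         ∀ x → dUY E ε x ≤ C₆ t ε
dUY≤C₆ t ε 0<ε (suc n) E connected δ≥C ¬S x =
  ℕₚ.≤-trans (ℕₚ.<⇒≤ (few-low-neighbours connected (inUY E ε) low x)) (ℕₚ.≤-trans (ℕₚ.m≤m+n K K) k+k≤C)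
  where
  q = ℚ.denominator-1 ε
  y₀-max = maxF-attained (degY E)
  open Concentration E t (4 * q) ¬S δ≥C (proj₁ y₀-max) (proj₂ y₀-max)
  open DegreeBound K t (4 * q) using (M; k+k≤C)
  low : ∀ y → inUY E ε y ≡ true → M * degY E y + 4 * Δ ≤ M * Δ
  low y y∈U = scale-by-4 q (degY E y) Δ
    (below-fraction ε 0<ε (degY E y) Δ (isYes⇒ (ℕtoℚ E (degY E y) ℚₚ.≤? (1ℚ ℚ.- ε) ℚ.* ℕtoℚ E Δ) y∈U))

lemma2p2 : Σ (ℕ → ℚ → ℕ) λ C₆ →
    ∀ (t : ℕ) (ε : ℚ) → 0ℚ ℚ.< ε → ε ℚ.< 1ℚ →
    ∀ (n : ℕ) (E : BipGraph n) →
    Connected E →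
    MinDegAtLeast E (C₆ t ε) →
    ¬ InducedStt E t →
    (∀ (x : Fin n) → dUY E ε x ≤ C₆ t ε) × (∀ (y : Fin n) → dUX E ε y ≤ C₆ t ε)
lemma2p2 = C₆ , λ t ε 0<ε _ n E connected δ≥C ¬S →
  dUY≤C₆ t ε 0<ε n E connected δ≥C ¬S ,
  dUY≤C₆ t ε 0<ε n (flip E) (Transpose.connected E connected) (Transpose.minDegAtLeast E δ≥C)
         (Transpose.¬inducedStt E ¬S)
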